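{- Let $\mathcal{H}$ be a hypergraph on a finite set $\Omega$ and let $i\in\{1,2\}$. Let $\mathcal{F}_i(\mathcal{H})$ and $\mathcal{I}_i(\mathcal{H})$ be the families of inclusion-minimal $\mathcal{R}_i$-forcing sets and inclusion-minimal $\mathcal{R}_i$-immune sets of $\mathcal{H}$, respectively. Then $\mathsf{Tr}(\mathcal{F}_i(\mathcal{H}))=\mathcal{I}_i(\mathcal{H})$ and $\mathsf{Tr}(\mathcal{I}_i(\mathcal{H}))=\mathcal{F}_i(\mathcal{H})$.
   Context: A hypergraph $\mathcal{H}$ on a finite set $\Omega$ has vertex set $V(\mathcal{H})=\Omega$ and a set of hyperedges $E(\mathcal{H})$, which are subsets of $\Omega$ forming a clutter (no hyperedge contains another). Two vertex subsets $X,Y$ are adjacent if some hyperedge contains both; a vertex $v$ is adjacent to $X$ if $\{v\}$ and $X$ are adjacent. Vertices are colored black or white. Rule $\mathcal{R}_1$: at each step, a non-empty set $X$ of black vertices contained in a hyperedge $E$, such that no white vertex outside $E$ is adjacent to $X$, forces all white vertices of $E$ to become black. Rule $\mathcal{R}_2$: at each step, a non-empty set $X$ of black vertices contained in a hyperedge $E$, such that $X$ is not contained in any other hyperedge containing white vertices, forces all white vertices of $E$ to become black. Starting from an initial black set $B$ and applying $\mathcal{R}_i$ until no more changes are possible, the final black set is independent of the order of steps; denote it $\mathcal{R}_i^\ast(B)$. An $\mathcal{R}_i$-forcing set is a non-empty $F\subseteq\Omega$ with $\mathcal{R}_i^\ast(F)=\Omega$; an $\mathcal{R}_i$-immune set is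 a non-empty $I\subseteq\Omega$ with $\mathcal{R}_i^\ast(\Omega\setminus I)=\Omega\setminus I$. For a family $\mathcal{C}$ of finite sets, $\mathsf{Tr}(\mathcal{C})$ denotes the family of inclusion-minimal sets intersecting every member of $\mathcal{C}$. -}

module Defs where

open import Data.Nat using (ℕ)
open import Data.Fin using (Fin)
open import Data.Fin.Subset public
  using (Subset; _∈_; _∉_; _⊆_; ∁; _∪_; ⊤; Nonempty)
open import Data.List using (List)
import Data.List.Membership.Propositional as LM
open import Data.Product using (Σ; ∃; _×_; _,_)
open import Relation.Nullary using (¬_)
open import Relation.Binary.PropositionalEquality using (_≡_; _≢_)
open import Relation.Binary.Construct.Closure.ReflexiveTransitive using (Star)
open import Function.Bundles using (_⇔_)

record Hypergraph (n : ℕ) : Set where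
  field
    edges   : List (Subset n)
    clutter : ∀ {E E′} → E LM.∈ edges → E′ LM.∈ edges → E ⊆ E′ → E ≡ E′
open Hypergraph public

module _ {n : ℕ} (H : Hypergraph n) where

  Adjacent : Subset n → Subset n → Set
  Adjacent X Y = ∃ λ E → E LM.∈ edges H × X ⊆ E × Y ⊆ E

  VAdjacent : Fin n → Subset n → Set
  VAdjacent v X = ∃ λ E → E LM.∈ edges H × v ∈ E × X ⊆ E

  -- R₁ forcing step from black set B to black set B ∪ E.
  -- (E must contain a white vertex, so that the step changes the colouring.)
  Step₁ : Subset n → Subset n → Set
  Step₁ B B′ = ∃ λ X → ∃ λ E →
      E LM.∈ edges H × Nonempty X × X ⊆ B × X ⊆ E
    × (∃ λ w → w ∈ E × w ∉ B)
    × (∀ v → v ∉ B → v ∉ E → ¬ VAdjacent v X)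
    × B′ ≡ B ∪ E

  Step₂ : Subset n → Subset n → Set
  Step₂ B B′ = ∃ λ X → ∃ λ E →
      E LM.∈ edges H × Nonempty X × X ⊆ B × X ⊆ E
    × (∃ λ w → w ∈ E × w ∉ B)
    × (∀ E′ → E′ LM.∈ edges H → E′ ≢ E → X ⊆ E′ → ¬ (∃ λ w → w ∈ E′ × w ∉ B))
    × B′ ≡ B ∪ E

data Rule : Set where
  R₁ R₂ : Rule

Step : {n : ℕ} → Rule → Hypergraph n → Subset n → Subset n → Set
Step R₁ H = Step₁ H
Step R₂ H = Step₂ H

module _ {n : ℕ} (i : Rule) (H : Hypergraph n) where

  Stable : Subset n → Set
  Stable B = ¬ (∃ λ B′ → Step i H B B′)

  -- C is a final black set obtained from B by applying the rule until no change
  -- (i.e. C = R_i^*(B); the order-independence is a fact from the paper).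
  Closure : Subset n → Subset n → Set
  Closure B C = Star (Step i H) B C × Stable C

  Forcing : Subset n → Set
  Forcing F = Nonempty F × Closure F ⊤

  Immune : Subset n → Set
  Immune I = Nonempty I × Closure (∁ I) (∁ I)

Minimal : {n : ℕ} → (Subset n → Set) → Subset n → Set
Minimal P S = P S × (∀ T → T ⊆ S → P T → T ≡ S)

Hits : {n : ℕ} → (Subset n → Set) → Subset n → Set
Hits C T = ∀ S → C S → ∃ λ x → x ∈ S × x ∈ T

Tr : {n : ℕ} → (Subset n → Set) → Subset n → Set
Tr C = Minimal (Hits C)

MinForcing MinImmune : {n : ℕ} → Rule → Hypergraph n → Subset n → Set
MinForcing i H = Minimal (Forcing i H)
MinImmune  i H = Minimal (Immune i H)

_≐_ : {n : ℕ} → (Subset n → Set) → (Subset n → Set) → Set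
A ≐ B = ∀ T → A T ⇔ B T

{-# OPTIONS --safe #-}
-- For an up-closed family P of subsets of a finite set, T meets every member of P
-- iff ∁ T ∉ P; this gives the blocker duality Tr (Min P) = Min (Hits P) and
-- Tr (Tr (Min P)) = Min P. Forcing sets are up-closed because both rules are
-- monotone in the black set. And T is a minimal immune set iff it is minimal with
-- ∁ T not forcing: if ∁ T is not forcing, its closure misses some vertex, and the
-- complement of that closure is an immune set inside T.
module Submission where

open import Defs
open import Data.Nat using (ℕ; suc; _<_)
open import Data.Nat.Induction using (<-wellFounded)
open import Data.Product using (∃; _×_; _,_; proj₁; proj₂)
open import Data.Empty using (⊥-elim)
open import Data.Sum using (inj₁; inj₂)
open import Data.Fin using (zero)
open import Data.Fin.Subset using (_∩_; _-_; ∣_∣; _⊂_; Empty)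
open import Data.Fin.Subset.Properties
open import Data.Fin.Properties using (any?; all?)
import Data.Bool.Properties as Bool
open import Data.Vec.Properties using (≡-dec)
open import Data.List.Relation.Unary.Any as Any using (Any)
import Data.List.Relation.Unary.All as All
import Data.List.Membership.Propositional as List
open import Relation.Nullary using (¬_; Dec; yes; no)
open import Relation.Nullary.Decidable
  using (_×-dec_; _→-dec_; ¬?; map′; decidable-stable)
import Relation.Nullary.Decidable as Dec
open import Relation.Unary using (Decidable)
open import Relation.Binary.PropositionalEquality using (_≡_; _≢_; refl; sym; subst)
open import Relation.Binary.Construct.Closure.ReflexiveTransitive using (Star; ε; _◅_)
open import Function.Bundles using (_⇔_; mk⇔; Equivalence)
import Function.Properties.Equivalence as ⇔
open import Induction.WellFounded using (Acc; acc)

open Equivalence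

private
  variable
    n : ℕ

_≟ₛ_ : (p q : Subset n) → Dec (p ≡ q)
_≟ₛ_ = ≡-dec Bool._≟_

∁-involutive : (p : Subset n) → ∁ (∁ p) ≡ p
∁-involutive p = ⊆-antisym (λ x∈ → x∉∁p⇒x∈p (x∈∁p⇒x∉p x∈))
                           (λ x∈ → x∉p⇒x∈∁p (x∈p⇒x∉∁p x∈))

⊆-∩ : {p q r : Subset n} → p ⊆ q → p ⊆ r → p ⊆ q ∩ r
⊆-∩ p⊆q p⊆r x∈p = x∈p∩q⁺ (p⊆q x∈p , p⊆r x∈p)

∁-Empty⇒⊤⊆ : {p : Subset n} → Empty (∁ p) → ⊤ ⊆ p
∁-Empty⇒⊤⊆ ∁p-empty {x} _ = x∉∁p⇒x∈p (λ x∈∁p → ∁p-empty (x , x∈∁p))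

∪-⊆ : {p q r : Subset n} → p ⊆ r → q ⊆ r → p ∪ q ⊆ r
∪-⊆ {p = p} {q} p⊆r q⊆r x∈ with x∈p∪q⁻ p q x∈
... | inj₁ x∈p = p⊆r x∈p
... | inj₂ x∈q = q⊆r x∈q

UpClosed : (Subset n → Set) → Set
UpClosed P = ∀ {S T} → S ⊆ T → P S → P T

≐-sym : {P Q : Subset n → Set} → P ≐ Q → Q ≐ P
≐-sym P≐Q T = ⇔.sym (P≐Q T)

≐-trans : {P Q R : Subset n → Set} → P ≐ Q → Q ≐ R → P ≐ R
≐-trans P≐Q Q≐R T = ⇔.trans (P≐Q T) (Q≐R T)

Minimal-resp : {P Q : Subset n → Set} → P ≐ Q → Minimal P ≐ Minimal Q
Minimal-resp P≐Q T = mk⇔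
  (λ (pT , min) → to (P≐Q T) pT , λ S S⊆T qS → min S S⊆T (from (P≐Q S) qS))
  (λ (qT , min) → from (P≐Q T) qT , λ S S⊆T pS → min S S⊆T (to (P≐Q S) pS))

Hits-resp : {P Q : Subset n → Set} → P ≐ Q → Hits P ≐ Hits Q
Hits-resp P≐Q T = mk⇔ (λ h S qS → h S (from (P≐Q S) qS))
                      (λ h S pS → h S (to (P≐Q S) pS))

Minimal-≐ : {P Q : Subset n → Set} → (∀ {S} → P S → Q S) →
            (∀ {S} → Q S → ∃ λ T → T ⊆ S × P T) → Minimal P ≐ Minimal Q
Minimal-≐ {P = P} {Q} P⇒Q Q⇒P⊆ S = mk⇔ minP⇒minQ minQ⇒minP
  where
  minP⇒minQ : Minimal P S → Minimal Q S
  minP⇒minQ (pS , min) = P⇒Q pS , λ T T⊆S qT →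
    let (U , U⊆T , pU) = Q⇒P⊆ qT
        U≡S = min U (⊆-trans U⊆T T⊆S) pU
    in ⊆-antisym T⊆S (subst (_⊆ T) U≡S U⊆T)
  minQ⇒minP : Minimal Q S → Minimal P S
  minQ⇒minP (qS , min) = let (U , U⊆S , pU) = Q⇒P⊆ qS in
    subst P (min U U⊆S (P⇒Q pU)) pU , λ T T⊆S pT → min T T⊆S (P⇒Q pT)

Hits-upClosed : {P : Subset n → Set} → UpClosed (Hits P)
Hits-upClosed S⊆T h F pF = let (x , x∈F , x∈S) = h F pF in x , x∈F , S⊆T x∈S

Hits⇔¬∁ : {P : Subset n → Set} → UpClosed P → ∀ T → Hits P T ⇔ (¬ P (∁ T))
Hits⇔¬∁ {P = P} up T = mk⇔ misses hits
  where
  misses : Hits P T → ¬ P (∁ T)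
  misses h p∁T with h (∁ T) p∁T
  ... | x , x∈∁T , x∈T = x∈∁p⇒x∉p x∈∁T x∈T
  hits : ¬ P (∁ T) → Hits P T
  hits ¬p∁T F pF with nonempty? (F ∩ T)
  ... | yes (x , x∈F∩T) = x , x∈p∩q⁻ F T x∈F∩T
  ... | no F∩T-empty = ⊥-elim (¬p∁T (up F⊆∁T pF))
    where
    F⊆∁T : F ⊆ ∁ T
    F⊆∁T x∈F = x∉p⇒x∈∁p (λ x∈T → F∩T-empty (_ , x∈p∩q⁺ (x∈F , x∈T)))

module _ {P : Subset n → Set} (up : UpClosed P) (P? : Decidable P) where

  Hits? : Decidable (Hits P)
  Hits? T = Dec.map (⇔.sym (Hits⇔¬∁ up T)) (¬? (P? (∁ T)))

  Hits-Hits : Hits (Hits P) ≐ P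
  Hits-Hits S = mk⇔ hits⇒P (λ pS T hT → let (x , x∈S , x∈T) = hT S pS in x , x∈T , x∈S)
    where
    hits⇒P : Hits (Hits P) S → P S
    hits⇒P h = decidable-stable (P? S) λ ¬pS →
      to (Hits⇔¬∁ Hits-upClosed S) h
         (from (Hits⇔¬∁ up (∁ S)) (λ p → ¬pS (subst P (∁-involutive S) p)))

  minimal-⊆ : ∀ S → P S → ∃ λ S₀ → S₀ ⊆ S × Minimal P S₀
  minimal-⊆ S = go S (<-wellFounded ∣ S ∣)
    where
    go : ∀ S → Acc _<_ ∣ S ∣ → P S → ∃ λ S₀ → S₀ ⊆ S × Minimal P S₀
    go S (acc rec) pS with any? (λ x → (x ∈? S) ×-dec P? (S - x))
    ... | yes (x , x∈S , pS-x) =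
      let (S₀ , S₀⊆S-x , min) = go (S - x) (rec (x∈p⇒∣p-x∣<∣p∣ x∈S)) pS-x
      in S₀ , ⊆-trans S₀⊆S-x (p─q⊆p S _) , min
    ... | no no-removable = S , ⊆-refl , pS , λ T T⊆S pT →
      ⊆-antisym T⊆S λ {y} y∈S → decidable-stable (y ∈? T) λ y∉T →
        no-removable (y , y∈S , up (λ z∈T → x∈p∧x≢y⇒x∈p-y (T⊆S z∈T)
                                      (λ { refl → y∉T z∈T })) pT)

  Hits-Minimal : Hits (Minimal P) ≐ Hits P
  Hits-Minimal T = mk⇔ hitsMin⇒hits (λ h S min → h S (proj₁ min))
    where
    hitsMin⇒hits : Hits (Minimal P) T → Hits P T
    hitsMin⇒hits h S pS = let (S₀ , S₀⊆S , min) = minimal-⊆ S pS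
                              (x , x∈S₀ , x∈T) = h S₀ min
                          in x , S₀⊆S x∈S₀ , x∈T

White : Subset n → Subset n → Set
White B E = ∃ λ w → w ∈ E × w ∉ B

White? : (B E : Subset n) → Dec (White B E)
White? B E = any? (λ w → (w ∈? E) ×-dec ¬? (w ∈? B))

¬White⇒⊆ : {B E : Subset n} → ¬ White B E → E ⊆ B
¬White⇒⊆ {B = B} ¬white {x} x∈E = decidable-stable (x ∈? B) (λ x∉B → ¬white (x , x∈E , x∉B))

module Propagation (H : Hypergraph n) where

  MayForce : Rule → Subset n → Subset n → Subset n → Set
  MayForce R₁ B E X = ∀ v → v ∉ B → v ∉ E → ¬ VAdjacent H v X
  MayForce R₂ B E X = ∀ E′ → E′ List.∈ edges H → E′ ≢ E → X ⊆ E′ → ¬ White B E′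

  -- Taking X = B ∩ E loses nothing, since the side conditions only get weaker as X grows.
  Fires : Rule → Subset n → Subset n → Set
  Fires r B E = Nonempty (B ∩ E) × White B E × MayForce r B E (B ∩ E)

  MayForce-mono : ∀ r {B C E X Y} → B ⊆ C → X ⊆ Y → MayForce r B E X → MayForce r C E Y
  MayForce-mono R₁ B⊆C X⊆Y may v v∉C v∉E (E′ , E′∈H , v∈E′ , Y⊆E′) =
    may v (λ v∈B → v∉C (B⊆C v∈B)) v∉E (E′ , E′∈H , v∈E′ , ⊆-trans X⊆Y Y⊆E′)
  MayForce-mono R₂ B⊆C X⊆Y may E′ E′∈H E′≢E Y⊆E′ (w , w∈E′ , w∉C) =
    may E′ E′∈H E′≢E (⊆-trans X⊆Y Y⊆E′) (w , w∈E′ , λ w∈B → w∉C (B⊆C w∈B))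

  Fires-mono : ∀ r {B C E} → B ⊆ C → White C E → Fires r B E → Fires r C E
  Fires-mono r {B} {C} {E} B⊆C white (ne , _ , may) =
    (proj₁ ne , B∩E⊆C∩E (proj₂ ne)) , white , MayForce-mono r B⊆C B∩E⊆C∩E may
    where
    B∩E⊆C∩E : B ∩ E ⊆ C ∩ E
    B∩E⊆C∩E = ⊆-∩ (⊆-trans (p∩q⊆p B E) B⊆C) (p∩q⊆q B E)

  Step⇒Fires : ∀ r {B B′} → Step r H B B′ →
               ∃ λ E → E List.∈ edges H × Fires r B E × B′ ≡ B ∪ E
  Step⇒Fires R₁ (X , E , E∈H , (x , x∈X) , X⊆B , X⊆E , white , may , refl) =
    E , E∈H , ((x , ⊆-∩ X⊆B X⊆E x∈X) , white , MayForce-mono R₁ ⊆-refl (⊆-∩ X⊆B X⊆E) may) , refl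
  Step⇒Fires R₂ (X , E , E∈H , (x , x∈X) , X⊆B , X⊆E , white , may , refl) =
    E , E∈H , ((x , ⊆-∩ X⊆B X⊆E x∈X) , white , MayForce-mono R₂ ⊆-refl (⊆-∩ X⊆B X⊆E) may) , refl

  Fires⇒Step : ∀ r {B E} → E List.∈ edges H → Fires r B E → Step r H B (B ∪ E)
  Fires⇒Step R₁ {B} {E} E∈H (ne , white , may) =
    B ∩ E , E , E∈H , ne , p∩q⊆p B E , p∩q⊆q B E , white , may , refl
  Fires⇒Step R₂ {B} {E} E∈H (ne , white , may) =
    B ∩ E , E , E∈H , ne , p∩q⊆p B E , p∩q⊆q B E , white , may , refl

  VAdjacent? : ∀ v X → Dec (VAdjacent H v X)
  VAdjacent? v X = map′ found lose (Any.any? (λ E → (v ∈? E) ×-dec (X ⊆? E)) (edges H))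
    where
    found : Any (λ E → v ∈ E × X ⊆ E) (edges H) → VAdjacent H v X
    found a with List.find a
    ... | E , E∈H , v∈E , X⊆E = E , E∈H , v∈E , X⊆E
    lose : VAdjacent H v X → Any (λ E → v ∈ E × X ⊆ E) (edges H)
    lose (E , E∈H , v∈E , X⊆E) = List.lose E∈H (v∈E , X⊆E)

  MayForce? : ∀ r B E X → Dec (MayForce r B E X)
  MayForce? R₁ B E X = all? (λ v → ¬? (v ∈? B) →-dec ¬? (v ∈? E) →-dec ¬? (VAdjacent? v X))
  MayForce? R₂ B E X =
    map′ (λ all E′ E′∈H → All.lookup all E′∈H) (λ may → All.tabulate (λ {E′} → may E′))
         (All.all? (λ E′ → ¬? (E′ ≟ₛ E) →-dec (X ⊆? E′) →-dec ¬? (White? B E′)) (edges H))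

  Fires? : ∀ r B E → Dec (Fires r B E)
  Fires? r B E = nonempty? (B ∩ E) ×-dec White? B E ×-dec MayForce? r B E (B ∩ E)

  Step? : ∀ r B → Dec (∃ λ B′ → Step r H B B′)
  Step? r B with Any.any? (Fires? r B) (edges H)
  ... | yes fires = let (E , E∈H , fE) = List.find fires in yes (B ∪ E , Fires⇒Step r E∈H fE)
  ... | no ¬fires = no λ (B′ , step) →
    let (E , E∈H , fE , _) = Step⇒Fires r step in ¬fires (List.lose E∈H fE)

  Step⇒⊂ : ∀ r {B B′} → Step r H B B′ → B ⊂ B′
  Step⇒⊂ r {B} step with Step⇒Fires r step
  ... | E , _ , (_ , (w , w∈E , w∉B) , _) , refl = p⊆p∪q E , w , q⊆p∪q B E w∈E , w∉B

  Star⇒⊆ : ∀ r {B C} → Star (Step r H) B C → B ⊆ C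
  Star⇒⊆ r ε = ⊆-refl
  Star⇒⊆ r (step ◅ steps) = ⊆-trans (proj₁ (Step⇒⊂ r step)) (Star⇒⊆ r steps)

  ⊤-stable : ∀ r → Stable r H ⊤
  ⊤-stable r (_ , step) with Step⇒Fires r step
  ... | _ , _ , (_ , (_ , _ , w∉⊤) , _) , _ = w∉⊤ ∈⊤

  Empty-stable : ∀ r {B} → Empty B → Stable r H B
  Empty-stable r {B} empty (_ , step) with Step⇒Fires r step
  ... | E , _ , ((x , x∈B∩E) , _) , _ = empty (x , proj₁ (x∈p∩q⁻ B E x∈B∩E))

  -- A hyperedge that fires from B and is not yet inside C still fires from C, by Fires-mono.
  Star-⊆-Stable : ∀ r {B C D} → B ⊆ C → Stable r H C → Star (Step r H) B D → D ⊆ C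
  Star-⊆-Stable r B⊆C stable ε = B⊆C
  Star-⊆-Stable r {B} {C} B⊆C stable (step ◅ steps) with Step⇒Fires r step
  ... | E , E∈H , fE , refl with White? C E
  ...   | yes white = ⊥-elim (stable (C ∪ E , Fires⇒Step r E∈H (Fires-mono r B⊆C white fE)))
  ...   | no ¬white = Star-⊆-Stable r (∪-⊆ B⊆C (¬White⇒⊆ ¬white)) stable steps

  closure : ∀ r B → ∃ λ C → Closure r H B C
  closure r B = go B (<-wellFounded ∣ ∁ B ∣)
    where
    go : ∀ B → Acc _<_ ∣ ∁ B ∣ → ∃ λ C → Closure r H B C
    go B (acc rec) with Step? r B
    ... | no stable = B , ε , stable
    ... | yes (B′ , step) =
      let (C , steps , stable) = go B′ (rec (p⊂q⇒∣p∣<∣q∣ (p⊂q⇒∁p⊃∁q (Step⇒⊂ r step))))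
      in C , step ◅ steps , stable

module Duality {m : ℕ} (H : Hypergraph (suc m)) (i : Rule) where
  open Propagation H

  Forcing? : Decidable (Forcing i H)
  Forcing? F with nonempty? F | closure i F
  ... | no empty | _ = no (λ forcing → empty (proj₁ forcing))
  ... | yes ne | C , steps , stable with C ≟ₛ ⊤
  ...   | yes refl = yes (ne , steps , stable)
  ...   | no C≢⊤ = no λ (_ , steps⊤ , _) →
    C≢⊤ (⊆-antisym ⊆⊤ (Star-⊆-Stable i (Star⇒⊆ i steps) stable steps⊤))

  Forcing-upClosed : UpClosed (Forcing i H)
  Forcing-upClosed {S} {T} S⊆T ((x , x∈S) , steps⊤ , _) with closure i T
  ... | C , steps , stable = (x , S⊆T x∈S) , subst (Star (Step i H) T) C≡⊤ steps , ⊤-stable i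
    where
    C≡⊤ : C ≡ ⊤
    C≡⊤ = ⊆-antisym ⊆⊤ (Star-⊆-Stable i (⊆-trans S⊆T (Star⇒⊆ i steps)) stable steps⊤)

  Immune⇒¬Forcing∁ : ∀ {T} → Immune i H T → ¬ Forcing i H (∁ T)
  Immune⇒¬Forcing∁ ((x , x∈T) , _ , stable) (_ , steps⊤ , _) =
    x∈∁p⇒x∉p (Star-⊆-Stable i ⊆-refl stable steps⊤ ∈⊤) x∈T

  ¬Forcing∁⇒Immune-⊆ : ∀ {T} → ¬ Forcing i H (∁ T) → ∃ λ I → I ⊆ T × Immune i H I
  ¬Forcing∁⇒Immune-⊆ {T} ¬forcing with nonempty? (∁ T)
  ... | no ∁T-empty =
    T , ⊆-refl , (zero , ∁-Empty⇒⊤⊆ ∁T-empty ∈⊤) , ε , Empty-stable i ∁T-empty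
  ... | yes ∁T-ne with closure i (∁ T)
  ...   | C , steps , stable with nonempty? (∁ C)
  ...     | yes ∁C-ne =
    ∁ C , ∁C⊆T , ∁C-ne , subst (λ B → Closure i H B B) (sym (∁-involutive C)) (ε , stable)
    where
    ∁C⊆T : ∁ C ⊆ T
    ∁C⊆T x∈∁C = x∉∁p⇒x∈p (λ x∈∁T → x∈∁p⇒x∉p x∈∁C (Star⇒⊆ i steps x∈∁T))
  ...     | no ∁C-empty = ⊥-elim (¬forcing (∁T-ne , subst (Star (Step i H) (∁ T)) C≡⊤ steps , ⊤-stable i))
    where
    C≡⊤ : C ≡ ⊤
    C≡⊤ = ⊆-antisym ⊆⊤ (∁-Empty⇒⊤⊆ ∁C-empty)

  MinImmune≐Minimal-Hits : MinImmune i H ≐ Minimal (Hits (Forcing i H))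
  MinImmune≐Minimal-Hits = Minimal-≐
    (λ {T} immune → from (Hits⇔¬∁ Forcing-upClosed T) (Immune⇒¬Forcing∁ immune))
    (λ {T} hits → ¬Forcing∁⇒Immune-⊆ (to (Hits⇔¬∁ Forcing-upClosed T) hits))

proposition1 : ∀ {n : ℕ} (H : Hypergraph (suc n)) (i : Rule)
    → (Tr (MinForcing i H) ≐ MinImmune i H) × (Tr (MinImmune i H) ≐ MinForcing i H)
proposition1 H i = Tr-MinForcing , Tr-MinImmune
  where
  open Duality H i

  Tr-MinForcing : Tr (MinForcing i H) ≐ MinImmune i H
  Tr-MinForcing = ≐-trans (Minimal-resp (Hits-Minimal Forcing-upClosed Forcing?))
                          (≐-sym MinImmune≐Minimal-Hits)

  Tr-MinImmune : Tr (MinImmune i H) ≐ MinForcing i H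
  Tr-MinImmune = Minimal-resp (≐-trans (Hits-resp MinImmune≐Minimal-Hits)
    (≐-trans (Hits-Minimal Hits-upClosed (Hits? Forcing-upClosed Forcing?))
             (Hits-Hits Forcing-upClosed Forcing?)))
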